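{- Let $p,r$ be positive integers and $k$ a nonnegative integer. Then $R_{p,r}(k) = \frac{r}{kp+r}\binom{kp+r}{k}$ equals the number of distinct planar embeddings of trees with $k+1$ internal vertices such that every internal vertex has degree $p+1$, except the internal vertex incident to the leftmost terminal edge, which has degree $r+1$.
   Context: Planar embeddings are of finite trees drawn in a closed half-plane so that the degree-one vertices (terminal/boundary vertices) lie on the boundary line, which is linearly ordered from left to right, and all other (internal) vertices lie in the open half-plane, with no edge crossings. The terminal edges are the edges incident to boundary vertices; the leftmost terminal edge is the one at the leftmost boundary vertex. Two embeddings are considered the same if there is a homeomorphism of the half-plane carrying one to the other and preserving the left-to-right order of the boundary vertices. -}

module Defs where

open import Data.Nat using (ℕ; zero; suc; _+_; _*_)
open import Data.Nat.Combinatorics using (_C_)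
open import Data.List using (List; []; _∷_; length)
open import Data.List.Relation.Unary.All using (All)
open import Data.Product using (Σ; _×_)
open import Data.Fin using (Fin)
open import Function.Bundles using (_↔_)
open import Relation.Binary.PropositionalEquality using (_≡_)

-- A vertex together with the ordered (left-to-right) list of its
-- neighbours other than the one towards the root.  A vertex with no
-- further neighbours is a degree-one (boundary/terminal) vertex.
data PTree : Set where
  node : List PTree → PTree

mutual
  internals : PTree → ℕ
  internals (node [])       = 0
  internals (node (c ∷ cs)) = suc (internalsL (c ∷ cs))

  internalsL : List PTree → ℕ
  internalsL []       = 0
  internalsL (c ∷ cs) = internals c + internalsL cs

-- A half-plane planar embedding of a tree (with at least one internal
-- vertex) is encoded by the internal vertex v incident to the leftmost
-- terminal edge: the root is v, its neighbour via the leftmost terminal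
-- edge is the leftmost boundary vertex (implicit), and 'node cs' lists
-- the remaining neighbours of v in planar (left-to-right) order.
-- Degree of v = 1 + length cs.
Embedding : Set
Embedding = PTree

-- Every non-root vertex is either a boundary vertex (no children) or an
-- internal vertex of degree p+1 (one parent edge + p children).
data NonRootOK (p : ℕ) : PTree → Set where
  boundary : NonRootOK p (node [])
  internal : ∀ {cs} → length cs ≡ p → All (NonRootOK p) cs → NonRootOK p (node cs)

data HasShape (p r k : ℕ) : Embedding → Set where
  shape : ∀ {cs} → length cs ≡ r → All (NonRootOK p) cs →
          suc (internalsL cs) ≡ suc k → HasShape p r k (node cs)

ShapedEmbeddings : ℕ → ℕ → ℕ → Set
ShapedEmbeddings p r k = Σ Embedding (HasShape p r k)

HasCardinality : Set → ℕ → Set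
HasCardinality S N = Fin N ↔ S

-- N = R_{p,r}(k) = r/(kp+r) * binom(kp+r, k), stated without division.
IsR : ℕ → ℕ → ℕ → ℕ → Set
IsR p r k N = N * (k * p + r) ≡ r * ((k * p + r) C k)

{-# OPTIONS --safe #-}

-- Removing the root and its leftmost boundary vertex turns a shaped embedding
-- into an ordered forest of r trees in which every internal vertex has p
-- children, k internal vertices in all.  Classifying by the first tree (a
-- leaf, or an internal root whose p subtrees are spliced into the forest)
-- gives R (k+1) (r+1) = R (k+1) r + R k (p+r).  Pascal's rule shows that
-- C(n, k) - p C(n-1, k-1), with n = kp + r, obeys the same recurrence, and
-- absorption, k C(n, k) = n C(n-1, k-1), turns this difference into r C(n, k) / n.
module Submission where

open import Defs
open import Data.Fin using (Fin; zero)
open import Data.Fin.Properties using (+↔⊎)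
open import Data.List using (List; []; _∷_; length; _++_; take; drop; replicate)
open import Data.List.Properties using (length-++; length-take; length-drop; length-replicate; take++drop≡id)
open import Data.List.Relation.Unary.All using (All)
open import Data.List.Relation.Unary.All.Properties using (++⁺; take⁺; drop⁺; replicate⁺)
open import Data.Nat using (ℕ; zero; suc; _+_; _*_; _∸_; _≤_; z≤n; s≤s)
open import Data.Nat.Combinatorics using (_C_; nC1≡n; nCk+nC[k+1]≡[n+1]C[k+1])
open import Data.Nat.Properties
  using (suc-injective; ≡-irrelevant; +-comm; +-assoc; +-suc; +-identityʳ; *-comm; *-identityˡ;
         *-identityʳ; *-zeroʳ; *-assoc; *-distribˡ-+; *-cancelˡ-≡; +-cancelʳ-≡; m≤m+n; m≤n⇒m⊓n≡m; m+n∸m≡n)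
open import Data.Nat.Tactic.RingSolver using (solve; solve-∀)
open import Data.Product using (Σ; _×_; _,_; proj₁)
open import Data.Sum using (_⊎_; inj₁; inj₂)
open import Data.Sum.Function.Propositional using (_⊎-cong_)
open import Function.Bundles using (_↔_; mk↔ₛ′)
open import Function.Properties.Inverse using (↔-trans; ↔-sym)
open import Relation.Unary using (Irrelevant)
open import Relation.Binary.PropositionalEquality
  using (_≡_; refl; sym; trans; cong; cong₂; subst; module ≡-Reasoning)

open ≡-Reasoning

[k+1]*[n+1]C[k+1]≡[n+1]*nCk : ∀ n k → suc k * (suc n C suc k) ≡ suc n * (n C k)
[k+1]*[n+1]C[k+1]≡[n+1]*nCk zero    zero    = refl
[k+1]*[n+1]C[k+1]≡[n+1]*nCk zero    (suc k) = *-zeroʳ (suc (suc k))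
[k+1]*[n+1]C[k+1]≡[n+1]*nCk (suc n) zero    = begin
  1 * (suc (suc n) C 1) ≡⟨ *-identityˡ _ ⟩
  suc (suc n) C 1       ≡⟨ nC1≡n (suc (suc n)) ⟩
  suc (suc n)           ≡⟨ *-identityʳ (suc (suc n)) ⟨
  suc (suc n) * 1       ∎
[k+1]*[n+1]C[k+1]≡[n+1]*nCk (suc n) (suc k) = begin
  suc (suc k) * (suc (suc n) C suc (suc k))
    ≡⟨ cong (suc (suc k) *_) (nCk+nC[k+1]≡[n+1]C[k+1] (suc n) (suc k)) ⟨
  suc (suc k) * (a + b)
    ≡⟨ *-distribˡ-+ (suc (suc k)) a b ⟩
  a + suc k * a + suc (suc k) * b
    ≡⟨ +-assoc a (suc k * a) _ ⟩
  a + (suc k * a + suc (suc k) * b)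
    ≡⟨ cong (a +_) (cong₂ _+_ ([k+1]*[n+1]C[k+1]≡[n+1]*nCk n k)
                              ([k+1]*[n+1]C[k+1]≡[n+1]*nCk n (suc k))) ⟩
  a + (suc n * (n C k) + suc n * (n C suc k))
    ≡⟨ cong (a +_) (*-distribˡ-+ (suc n) (n C k) (n C suc k)) ⟨
  a + suc n * (n C k + n C suc k)
    ≡⟨ cong (λ x → a + suc n * x) (nCk+nC[k+1]≡[n+1]C[k+1] n k) ⟩
  suc (suc n) * a ∎
  where
  a = suc n C suc k
  b = suc n C suc (suc k)

ratio-from-difference : ∀ {f p x k n r y} →
  f + p * y ≡ x → k * x ≡ n * y → n ≡ k * p + r → f * n ≡ r * x
ratio-from-difference {f} {p} {x} {k} {n} {r} {y} difference absorption size =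
  +-cancelʳ-≡ (k * p * x) (f * n) (r * x) (begin
    f * n + k * p * x     ≡⟨ solve (f ∷ n ∷ k ∷ p ∷ x ∷ []) ⟩
    f * n + p * (k * x)   ≡⟨ cong (λ z → f * n + p * z) absorption ⟩
    f * n + p * (n * y)   ≡⟨ solve (f ∷ n ∷ p ∷ y ∷ []) ⟩
    n * (f + p * y)       ≡⟨ cong (n *_) difference ⟩
    n * x                 ≡⟨ cong (_* x) size ⟩
    (k * p + r) * x       ≡⟨ solve (k ∷ p ∷ r ∷ x ∷ []) ⟩
    r * x + k * p * x     ∎)

module _ {A : Set} where

  take-++ : ∀ {n} (xs ys : List A) → length xs ≡ n → take n (xs ++ ys) ≡ xs
  take-++ []       ys refl = refl
  take-++ (x ∷ xs) ys refl = cong (x ∷_) (take-++ xs ys refl)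

  drop-++ : ∀ {n} (xs ys : List A) → length xs ≡ n → drop n (xs ++ ys) ≡ ys
  drop-++ []       ys refl = refl
  drop-++ (x ∷ xs) ys refl = drop-++ xs ys refl

  length-take-+ : ∀ m {n} (xs : List A) → length xs ≡ m + n → length (take m xs) ≡ m
  length-take-+ m {n} xs eq =
    trans (length-take m xs) (m≤n⇒m⊓n≡m (subst (m ≤_) (sym eq) (m≤m+n m n)))

  length-drop-+ : ∀ m {n} (xs : List A) → length xs ≡ m + n → length (drop m xs) ≡ n
  length-drop-+ m {n} xs eq = trans (length-drop m xs) (trans (cong (_∸ m) eq) (m+n∸m≡n m n))

internalsL-++ : ∀ ts us → internalsL (ts ++ us) ≡ internalsL ts + internalsL us
internalsL-++ []       us = refl
internalsL-++ (t ∷ ts) us =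
  trans (cong (internals t +_) (internalsL-++ ts us)) (sym (+-assoc (internals t) _ _))

internalsL-take-drop : ∀ n ts → internalsL (take n ts) + internalsL (drop n ts) ≡ internalsL ts
internalsL-take-drop n ts =
  trans (sym (internalsL-++ (take n ts) (drop n ts))) (cong internalsL (take++drop≡id n ts))

module Raney (q : ℕ) where

  p : ℕ
  p = suc q

  R : ℕ → ℕ → ℕ
  R zero    r       = 1
  R (suc k) zero    = 0
  R (suc k) (suc r) = R (suc k) r + R k (p + r)

  -- Here k * p + q + r = (k + 1) * p + r - 1.
  R-difference : ∀ k r → R (suc k) r + p * ((k * p + q + r) C k) ≡ suc (k * p + q + r) C suc k
  R-difference k zero = *-cancelˡ-≡ _ _ (suc k) (begin
    suc k * (p * (n C k))     ≡⟨ *-assoc (suc k) p (n C k) ⟨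
    suc k * p * (n C k)       ≡⟨ cong (_* (n C k)) size ⟩
    suc n * (n C k)           ≡⟨ [k+1]*[n+1]C[k+1]≡[n+1]*nCk n k ⟨
    suc k * (suc n C suc k)   ∎)
    where
    n = k * p + q + 0
    size : suc k * p ≡ suc n
    size = cong suc (trans (+-comm q (k * p)) (sym (+-identityʳ (k * p + q))))
  R-difference zero (suc r) = begin
    R 1 r + 1 + p * 1         ≡⟨ cong (_+ p * 1) (+-comm (R 1 r) 1) ⟩
    suc (R 1 r + p * 1)       ≡⟨ cong suc (R-difference zero r) ⟩
    suc (suc (q + r) C 1)     ≡⟨ cong suc (nC1≡n (suc (q + r))) ⟩
    suc (suc (q + r))         ≡⟨ cong suc (+-suc q r) ⟨
    suc (q + suc r)           ≡⟨ nC1≡n (suc (q + suc r)) ⟨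
    suc (q + suc r) C 1       ∎
  R-difference (suc k) (suc r) = begin
    a + b + p * (n C suc k)
      ≡⟨ cong (λ n → a + b + p * (n C suc k)) (+-suc (suc k * p + q) r) ⟩
    a + b + p * (suc m C suc k)
      ≡⟨ cong (λ x → a + b + p * x) (nCk+nC[k+1]≡[n+1]C[k+1] m k) ⟨
    a + b + p * (m C k + m C suc k)
      ≡⟨ interchange a b p (m C k) (m C suc k) ⟩
    (a + p * (m C suc k)) + (b + p * (m C k))
      ≡⟨ cong₂ _+_ (R-difference (suc k) r) shifted ⟩
    suc m C suc (suc k) + suc m C suc k
      ≡⟨ +-comm (suc m C suc (suc k)) _ ⟩
    suc m C suc k + suc m C suc (suc k)
      ≡⟨ nCk+nC[k+1]≡[n+1]C[k+1] (suc m) (suc k) ⟩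
    suc (suc m) C suc (suc k)
      ≡⟨ cong (λ n → suc n C suc (suc k)) (+-suc (suc k * p + q) r) ⟨
    suc n C suc (suc k) ∎
    where
    a = R (suc (suc k)) r
    b = R (suc k) (p + r)
    n = suc k * p + q + suc r
    m = suc k * p + q + r
    interchange : ∀ a b c x y → a + b + c * (x + y) ≡ (a + c * y) + (b + c * x)
    interchange = solve-∀
    shift : ∀ x y z w → x + z + (y + w) ≡ y + x + z + w
    shift = solve-∀
    shifted : b + p * (m C k) ≡ suc m C suc k
    shifted = subst (λ n → b + p * (n C k) ≡ suc n C suc k)
                    (shift (k * p) p q r)
                    (R-difference k (p + r))

  R-ratio : ∀ k r → R k (suc r) * (k * p + suc r) ≡ suc r * ((k * p + suc r) C k)
  R-ratio zero    r = *-comm 1 (suc r)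
  R-ratio (suc k) r =
    ratio-from-difference {R (suc k) (suc r)} {p} {k = suc k} {r = suc r} difference absorption refl
    where
    m = k * p + q + suc r
    n = suc k * p + suc r
    size : suc m ≡ n
    size = cong (λ x → suc (x + suc r)) (+-comm (k * p) q)
    difference : R (suc k) (suc r) + p * (m C k) ≡ n C suc k
    difference = subst (λ x → R (suc k) (suc r) + p * (m C k) ≡ x C suc k) size
                       (R-difference k (suc r))
    absorption : suc k * (n C suc k) ≡ n * (m C k)
    absorption = subst (λ x → suc k * (x C suc k) ≡ x * (m C k)) size
                       ([k+1]*[n+1]C[k+1]≡[n+1]*nCk m k)

module Forests (q : ℕ) where

  open import Data.List.Relation.Unary.All using ([]; _∷_)
  open Raney q using (p; R)

  -- Needs p ≠ 0: for p = 0, node [] is both a boundary and an internal vertex.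
  mutual
    NonRootOK-irrelevant : Irrelevant (NonRootOK p)
    NonRootOK-irrelevant boundary        boundary          = refl
    NonRootOK-irrelevant boundary        (internal () _)
    NonRootOK-irrelevant (internal () _) boundary
    NonRootOK-irrelevant (internal e ts) (internal e′ ts′) =
      cong₂ internal (≡-irrelevant e e′) (All-NonRootOK-irrelevant ts ts′)

    All-NonRootOK-irrelevant : Irrelevant (All (NonRootOK p))
    All-NonRootOK-irrelevant []       []         = refl
    All-NonRootOK-irrelevant (t ∷ ts) (t′ ∷ ts′) =
      cong₂ _∷_ (NonRootOK-irrelevant t t′) (All-NonRootOK-irrelevant ts ts′)

  IsForest : ℕ → ℕ → List PTree → Set
  IsForest k r ts = length ts ≡ r × All (NonRootOK p) ts × internalsL ts ≡ k

  Forest : ℕ → ℕ → Set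
  Forest k r = Σ (List PTree) (IsForest k r)

  IsForest-irrelevant : ∀ {k r} → Irrelevant (IsForest k r)
  IsForest-irrelevant (l , a , i) (l′ , a′ , i′) =
    cong₂ _,_ (≡-irrelevant l l′) (cong₂ _,_ (All-NonRootOK-irrelevant a a′) (≡-irrelevant i i′))

  Forest-≡ : ∀ {k r} {F G : Forest k r} → proj₁ F ≡ proj₁ G → F ≡ G
  Forest-≡ {F = ts , x} {G = .ts , y} refl = cong (ts ,_) (IsForest-irrelevant x y)

  leaves : ℕ → List PTree
  leaves r = replicate r (node [])

  internalsL-leaves : ∀ r → internalsL (leaves r) ≡ 0
  internalsL-leaves zero    = refl
  internalsL-leaves (suc r) = internalsL-leaves r

  internalsL≡0⇒leaves : ∀ ts → internalsL ts ≡ 0 → ts ≡ leaves (length ts)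
  internalsL≡0⇒leaves []                  _  = refl
  internalsL≡0⇒leaves (node [] ∷ ts)      eq = cong (node [] ∷_) (internalsL≡0⇒leaves ts eq)
  internalsL≡0⇒leaves (node (_ ∷ _) ∷ ts) ()

  Fin1↔Forest0 : ∀ r → Fin 1 ↔ Forest 0 r
  Fin1↔Forest0 r = mk↔ₛ′ (λ _ → all-leaves) (λ _ → zero) unique (λ { zero → refl })
    where
    all-leaves : Forest 0 r
    all-leaves = leaves r , length-replicate r , replicate⁺ r boundary , internalsL-leaves r
    unique : ∀ F → all-leaves ≡ F
    unique (ts , l , _ , i) = Forest-≡ (sym (trans (internalsL≡0⇒leaves ts i) (cong leaves l)))

  Fin0↔Forest[1+k]0 : ∀ k → Fin 0 ↔ Forest (suc k) 0
  Fin0↔Forest[1+k]0 k = mk↔ₛ′ (λ ()) (λ { ([] , _ , _ , ()) }) (λ { ([] , _ , _ , ()) }) (λ ())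

  graft : ∀ {k r} → Forest (suc k) r ⊎ Forest k (p + r) → Forest (suc k) (suc r)
  graft (inj₁ (ts , l , a , i)) = node [] ∷ ts , cong suc l , boundary ∷ a , i
  graft {k} (inj₂ (t ∷ ts , l , a₀ ∷ a , i)) =
    node (t ∷ take q ts) ∷ drop q ts ,
    cong suc (length-drop-+ q ts (suc-injective l)) ,
    internal (cong suc (length-take-+ q ts (suc-injective l))) (a₀ ∷ take⁺ q a) ∷ drop⁺ q a ,
    cong suc (begin
      internals t + internalsL (take q ts) + internalsL (drop q ts)
        ≡⟨ +-assoc (internals t) _ _ ⟩
      internals t + (internalsL (take q ts) + internalsL (drop q ts))
        ≡⟨ cong (internals t +_) (internalsL-take-drop q ts) ⟩
      internals t + internalsL ts
        ≡⟨ i ⟩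
      k ∎)

  ungraft : ∀ {k r} → Forest (suc k) (suc r) → Forest (suc k) r ⊎ Forest k (p + r)
  ungraft (node [] ∷ ts , l , _ ∷ a , i) = inj₁ (ts , suc-injective l , a , i)
  ungraft (node (u ∷ us) ∷ ts , l , internal e a₀ ∷ a , i) =
    inj₂ ((u ∷ us) ++ ts ,
          trans (length-++ (u ∷ us)) (cong₂ _+_ e (suc-injective l)) ,
          ++⁺ a₀ a ,
          trans (internalsL-++ (u ∷ us) ts) (suc-injective i))

  graft↔ : ∀ k r → (Forest (suc k) r ⊎ Forest k (p + r)) ↔ Forest (suc k) (suc r)
  graft↔ k r = mk↔ₛ′ graft ungraft graft∘ungraft ungraft∘graft
    where
    graft∘ungraft : ∀ F → graft (ungraft F) ≡ F
    graft∘ungraft (node [] ∷ ts , _ , _ ∷ _ , _) = Forest-≡ refl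
    graft∘ungraft (node (u ∷ us) ∷ ts , _ , internal e (_ ∷ _) ∷ _ , _) =
      Forest-≡ (cong₂ (λ vs ws → node (u ∷ vs) ∷ ws)
                      (take-++ us ts (suc-injective e))
                      (drop-++ us ts (suc-injective e)))
    ungraft∘graft : ∀ F → ungraft (graft F) ≡ F
    ungraft∘graft (inj₁ _) = cong inj₁ (Forest-≡ refl)
    ungraft∘graft (inj₂ (t ∷ ts , _ , _ ∷ _ , _)) =
      cong inj₂ (Forest-≡ (cong (t ∷_) (take++drop≡id q ts)))

  Fin-R↔Forest : ∀ k r → Fin (R k r) ↔ Forest k r
  Fin-R↔Forest zero    r       = Fin1↔Forest0 r
  Fin-R↔Forest (suc k) zero    = Fin0↔Forest[1+k]0 k
  Fin-R↔Forest (suc k) (suc r) =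
    ↔-trans +↔⊎ (↔-trans (Fin-R↔Forest (suc k) r ⊎-cong Fin-R↔Forest k (p + r)) (graft↔ k r))

  ShapedEmbeddings↔Forest : ∀ r k → ShapedEmbeddings p r k ↔ Forest k r
  ShapedEmbeddings↔Forest r k = mk↔ₛ′ to from (λ _ → Forest-≡ refl) from∘to
    where
    to : ShapedEmbeddings p r k → Forest k r
    to (node ts , shape l a i) = ts , l , a , suc-injective i
    from : Forest k r → ShapedEmbeddings p r k
    from (ts , l , a , i) = node ts , shape l a (cong suc i)
    from∘to : ∀ E → from (to E) ≡ E
    from∘to (node ts , shape l a i) = cong (λ i′ → node ts , shape l a i′) (≡-irrelevant _ i)

proposition3p1 : (p r k : ℕ) → 1 ≤ p → 1 ≤ r →
    Σ ℕ (λ N → IsR p r k N × HasCardinality (ShapedEmbeddings p r k) N)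
proposition3p1 (suc q) (suc r) k (s≤s z≤n) (s≤s z≤n) =
  R k (suc r) ,
  R-ratio k r ,
  ↔-trans (Fin-R↔Forest k (suc r)) (↔-sym (ShapedEmbeddings↔Forest (suc r) k))
  where
  open Raney q
  open Forests q
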